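{- Let $R$ be a commutative ring and $q\in R$ such that $R$ is $q$-torsion free and $qR$ is a prime ideal. Then for every $d\geq 1$ the group $A_d(R,q)$ is solvable.
   Context: For a commutative ring $B$, $\mathrm{Aut}(\mathbb{A}^1_B)$ denotes the group of polynomials $f\in B[T]$ invertible under composition, with group law composition. $A_d(R,q)$ is the subgroup of $\mathrm{Aut}(\mathbb{A}^1_{R/q^d})$ consisting of invertible polynomials of the form $a_0+a_1T+qa_2T^2+q^2a_3T^3+\cdots+q^{d-1}a_dT^d \bmod q^d$ with $a_i\in R$. -}

module Defs where

open import Level using (Level; _⊔_)
open import Algebra.Bundles using (CommutativeRing)
open import Data.Nat using (ℕ; zero; suc)
open import Data.List using (List; []; _∷_)
open import Data.Vec using (Vec; []; _∷_)
open import Data.Product using (Σ; ∃; _×_; _,_)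
open import Data.Sum using (_⊎_)
open import Relation.Nullary using (¬_)

module _ {c ℓ : Level} (R : CommutativeRing c ℓ) where
  open CommutativeRing R

  pow : Carrier → ℕ → Carrier
  pow x zero    = 1#
  pow x (suc n) = x * pow x n

  Divides : Carrier → Carrier → Set (c ⊔ ℓ)
  Divides a b = Σ Carrier λ k → b ≈ a * k

  TorsionFree : Carrier → Set (c ⊔ ℓ)
  TorsionFree q = ∀ x → q * x ≈ 0# → x ≈ 0#

  PrincipalPrime : Carrier → Set (c ⊔ ℓ)
  PrincipalPrime q = (¬ Divides q 1#)
                   × (∀ a b → Divides q (a * b) → Divides q a ⊎ Divides q b)

  -- congruence modulo m, i.e. equality in R/mR
  _≡[_]_ : Carrier → Carrier → Carrier → Set (c ⊔ ℓ)
  x ≡[ m ] y = Σ Carrier λ k → x ≈ y + m * k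

  -- polynomials: coefficient lists, constant term first
  Poly : Set c
  Poly = List Carrier

  coeff : Poly → ℕ → Carrier
  coeff []       n       = 0#
  coeff (a ∷ f)  zero    = a
  coeff (a ∷ f)  (suc n) = coeff f n

  _⊕_ : Poly → Poly → Poly
  []      ⊕ g       = g
  (a ∷ f) ⊕ []      = a ∷ f
  (a ∷ f) ⊕ (b ∷ g) = (a + b) ∷ (f ⊕ g)

  scale : Carrier → Poly → Poly
  scale a []      = []
  scale a (b ∷ g) = (a * b) ∷ scale a g

  _⊛_ : Poly → Poly → Poly
  []      ⊛ g = []
  (a ∷ f) ⊛ g = scale a g ⊕ (0# ∷ (f ⊛ g))

  -- composition: f ∘ₚ g = f(g(T))  (Horner)
  _∘ₚ_ : Poly → Poly → Poly
  []      ∘ₚ g = []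
  (a ∷ f) ∘ₚ g = (a ∷ []) ⊕ (g ⊛ (f ∘ₚ g))

  Tₚ : Poly
  Tₚ = 0# ∷ 1# ∷ []

  -- equality of polynomials in (R/mR)[T]
  PolyEq : Carrier → Poly → Poly → Set (c ⊔ ℓ)
  PolyEq m f g = ∀ n → coeff f n ≡[ m ] coeff g n

  IsInverse : Carrier → Poly → Poly → Set (c ⊔ ℓ)
  IsInverse m f g = PolyEq m (f ∘ₚ g) Tₚ × PolyEq m (g ∘ₚ f) Tₚ

  -- f ∈ Aut(A¹_{R/mR})
  InAut : Carrier → Poly → Set (c ⊔ ℓ)
  InAut m f = Σ Poly λ g → IsInverse m f g

  -- a₀ + a₁T + q a₂T² + … + q^(d-1) a_d T^d  from  (a₀, a₁, …, a_d)
  shapeTail : Carrier → ℕ → {n : ℕ} → Vec Carrier n → Poly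
  shapeTail q k []       = []
  shapeTail q k (a ∷ as) = (pow q k * a) ∷ shapeTail q (suc k) as

  shapePoly : Carrier → {n : ℕ} → Vec Carrier n → Poly
  shapePoly q []       = []
  shapePoly q (a ∷ as) = a ∷ shapeTail q 0 as

  -- membership in A_d(R,q) ⊆ Aut(A¹_{R/q^d})
  A : Carrier → ℕ → Poly → Set (c ⊔ ℓ)
  A q d f = InAut (pow q d) f
          × Σ (Vec Carrier (suc d)) λ a → PolyEq (pow q d) f (shapePoly q a)

  commutator : Poly → Poly → Poly → Poly → Poly
  commutator x y x' y' = x ∘ₚ (y ∘ₚ (x' ∘ₚ y'))

  -- derived subgroup [H,H] of a subgroup H ⊆ Aut(A¹_{R/mR}) (given by a predicate):
  -- the subgroup generated by commutators, i.e. finite products of commutators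
  -- (inverses of commutators are commutators), closed under equality in (R/mR)[T]
  data Derived (m : Carrier) (H : Poly → Set (c ⊔ ℓ)) : Poly → Set (c ⊔ ℓ) where
    derived-id  : ∀ f → PolyEq m f Tₚ → Derived m H f
    derived-mul : ∀ x x' y y' h f → H x → H y → IsInverse m x x' → IsInverse m y y'
                → Derived m H h
                → PolyEq m f (commutator x y x' y' ∘ₚ h)
                → Derived m H f

  DerivedSeries : Carrier → (Poly → Set (c ⊔ ℓ)) → ℕ → Poly → Set (c ⊔ ℓ)
  DerivedSeries m H zero    = H
  DerivedSeries m H (suc n) = Derived m (DerivedSeries m H n)

  Solvable : Carrier → (Poly → Set (c ⊔ ℓ)) → Set (c ⊔ ℓ)
  Solvable m H = Σ ℕ λ n → ∀ f → DerivedSeries m H n f → PolyEq m f Tₚ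

-- Write m = q^d.  Every element of A_d is affine modulo q.  We exhibit a
-- chain of "characters" (partial homomorphisms from Aut(A¹_{R/mR}) to
-- commutative monoids) whose kernels form a descending filtration:
--   * on maps affine mod q, the linear coefficient in (R/q)^× ;
--   * on translations T + c mod q, the constant c in (R/q, +) ;
--   * on maps ≡ T (mod q^k), k ≥ 1, writing them as T + q^k·a modulo
--     q^(k+1), the coefficients of q^k·a in (R/q^(k+1), +).
-- A commutator has trivial value under any such character, so each derived
-- subgroup lies in the next kernel, and the (d+1)-st derived subgroup of
-- A_d consists of maps ≡ T (mod q^d), i.e. it is trivial.
module Submission where

open import Defs
open import Level using (Level; _⊔_)
open import Algebra.Bundles using (CommutativeRing; CommutativeMonoid)
open import Data.Nat using (ℕ; _≤_; zero; suc; s≤s; z≤n)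
open import Data.Nat.Properties using (≤-refl; n≤1+n; <⇒≤)
open import Data.List using ([]; _∷_)
open import Data.Vec using (Vec; []; _∷_)
open import Data.Product using (Σ; _×_; _,_; proj₁; proj₂)
open import Relation.Binary.Bundles using (Setoid)
import Algebra.Solver.Ring.NaturalCoefficients.Default as SemiringSolver
import Algebra.Properties.Ring as RingProperties
import Algebra.Construct.Pointwise as Pointwise
import Algebra.Solver.CommutativeMonoid as MonoidSolver
import Relation.Binary.Reasoning.Setoid as SetoidReasoning

module Basics {c ℓ : Level} (R : CommutativeRing c ℓ) where
  open CommutativeRing R using (Carrier; _≈_; refl)

  infix  4 _≡_[mod_] _≋_[mod_]
  infixl 6 _⊞_
  infixl 7 _⊠_
  infixr 7 _•_
  infixr 9 _◦_
  infixl 10 _⟨_⟩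

  _≡_[mod_] : Carrier → Carrier → Carrier → Set (c ⊔ ℓ)
  x ≡ y [mod m ] = _≡[_]_ R x m y

  -- equality in (R/mR)[T]; a record (rather than Defs' PolyEq itself) so
  -- that both polynomials can be inferred from a proof
  record _≋_[mod_] (f g : Poly R) (m : Carrier) : Set (c ⊔ ℓ) where
    constructor coeffwise
    field at : PolyEq R m f g
  open _≋_[mod_] public

  _⟨_⟩ : Poly R → ℕ → Carrier
  _⟨_⟩ = coeff R

  _⊞_ _⊠_ _◦_ : Poly R → Poly R → Poly R
  _⊞_ = _⊕_ R
  _⊠_ = _⊛_ R
  _◦_ = _∘ₚ_ R

  _•_ : Carrier → Poly R → Poly R
  _•_ = scale R

  X : Poly R
  X = Tₚ R

  affine : Carrier → Carrier → Poly R
  affine a₀ a₁ = a₀ ∷ a₁ ∷ []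

  tail : Poly R → Poly R
  tail []      = []
  tail (a ∷ f) = f

  coeff-tail : ∀ f n → f ⟨ suc n ⟩ ≈ tail f ⟨ n ⟩
  coeff-tail []      n = refl
  coeff-tail (a ∷ f) n = refl

  pair-induction : (P : Poly R → Poly R → Set (c ⊔ ℓ))
                 → P [] [] → (∀ f g → P (tail f) (tail g) → P f g) → ∀ f g → P f g
  pair-induction P base step []      []      = base
  pair-induction P base step []      (b ∷ g) = step [] (b ∷ g) (pair-induction P base step [] g)
  pair-induction P base step (a ∷ f) []      = step (a ∷ f) [] (pair-induction P base step f [])
  pair-induction P base step (a ∷ f) (b ∷ g) = step (a ∷ f) (b ∷ g) (pair-induction P base step f g)

module Congruence {c ℓ : Level} (R : CommutativeRing c ℓ) where
  open CommutativeRing R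
  open Basics R using (_≡_[mod_])
  open SetoidReasoning setoid
  open SemiringSolver commutativeSemiring using (solve; _:=_; _:+_; _:*_; con)
  open RingProperties ring using (-‿distribʳ-*; -‿+-comm)

  module _ {m : Carrier} where

    ≈⇒≡ : ∀ {x y} → x ≈ y → x ≡ y [mod m ]
    ≈⇒≡ {x} {y} x≈y = 0# , (begin
      x            ≈⟨ x≈y ⟩
      y            ≈⟨ solve 2 (λ y m → y := y :+ m :* con 0) refl y m ⟩
      y + m * 0#   ∎)

    ≡-sym : ∀ {x y} → x ≡ y [mod m ] → y ≡ x [mod m ]
    ≡-sym {x} {y} (k , x≈y+mk) = - k , (begin
      y                     ≈⟨ solve 2 (λ y m → y := y :+ m :* con 0) refl y m ⟩
      y + m * 0#            ≈⟨ +-congˡ (*-congˡ (sym (-‿inverseʳ k))) ⟩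
      y + m * (k + - k)     ≈⟨ solve 4 (λ y m k k' → y :+ m :* (k :+ k') := (y :+ m :* k) :+ m :* k') refl y m k (- k) ⟩
      (y + m * k) + m * - k ≈⟨ +-congʳ (sym x≈y+mk) ⟩
      x + m * - k           ∎)

    ≡-trans : ∀ {x y z} → x ≡ y [mod m ] → y ≡ z [mod m ] → x ≡ z [mod m ]
    ≡-trans {x} {y} {z} (k , x≈y+mk) (l , y≈z+ml) = l + k , (begin
      x                   ≈⟨ x≈y+mk ⟩
      y + m * k           ≈⟨ +-congʳ y≈z+ml ⟩
      (z + m * l) + m * k ≈⟨ solve 4 (λ z m l k → (z :+ m :* l) :+ m :* k := z :+ m :* (l :+ k)) refl z m l k ⟩
      z + m * (l + k)     ∎)

    ≡-+ : ∀ {x x′ y y′} → x ≡ x′ [mod m ] → y ≡ y′ [mod m ] → x + y ≡ x′ + y′ [mod m ]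
    ≡-+ {x} {x′} {y} {y′} (k , x≈) (l , y≈) = k + l , (begin
      x + y                        ≈⟨ +-cong x≈ y≈ ⟩
      (x′ + m * k) + (y′ + m * l)  ≈⟨ solve 5 (λ x y m k l → (x :+ m :* k) :+ (y :+ m :* l) := (x :+ y) :+ m :* (k :+ l)) refl x′ y′ m k l ⟩
      (x′ + y′) + m * (k + l)      ∎)

    ≡-* : ∀ {x x′ y y′} → x ≡ x′ [mod m ] → y ≡ y′ [mod m ] → x * y ≡ x′ * y′ [mod m ]
    ≡-* {x} {x′} {y} {y′} (k , x≈) (l , y≈) = k * y′ + x′ * l + m * (k * l) , (begin
      x * y                        ≈⟨ *-cong x≈ y≈ ⟩
      (x′ + m * k) * (y′ + m * l)  ≈⟨ solve 5 (λ x y m k l → (x :+ m :* k) :* (y :+ m :* l)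
                                        := x :* y :+ m :* (k :* y :+ x :* l :+ m :* (k :* l))) refl x′ y′ m k l ⟩
      x′ * y′ + m * (k * y′ + x′ * l + m * (k * l)) ∎)

    ≡-neg : ∀ {x x′} → x ≡ x′ [mod m ] → - x ≡ - x′ [mod m ]
    ≡-neg {x} {x′} (k , x≈) = - k , (begin
      - x                ≈⟨ -‿cong x≈ ⟩
      - (x′ + m * k)     ≈⟨ sym (-‿+-comm x′ (m * k)) ⟩
      - x′ + - (m * k)   ≈⟨ +-congˡ (-‿distribʳ-* m k) ⟩
      - x′ + m * - k     ∎)

  quotient : Carrier → CommutativeRing c (c ⊔ ℓ)
  quotient m = record
    { Carrier = Carrier ; _≈_ = _≡_[mod m ] ; _+_ = _+_ ; _*_ = _*_ ; -_ = -_ ; 0# = 0# ; 1# = 1#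
    ; isCommutativeRing = record
      { isRing = record
        { +-isAbelianGroup = record
          { isGroup = record
            { isMonoid = record
              { isSemigroup = record
                { isMagma = record
                  { isEquivalence = record { refl = ≈⇒≡ refl ; sym = ≡-sym ; trans = ≡-trans }
                  ; ∙-cong = ≡-+ }
                ; assoc = λ a b c → ≈⇒≡ (+-assoc a b c) }
              ; identity = (λ a → ≈⇒≡ (+-identityˡ a)) , (λ a → ≈⇒≡ (+-identityʳ a)) }
            ; inverse = (λ a → ≈⇒≡ (-‿inverseˡ a)) , (λ a → ≈⇒≡ (-‿inverseʳ a))
            ; ⁻¹-cong = ≡-neg }
          ; comm = λ a b → ≈⇒≡ (+-comm a b) }
        ; *-cong = ≡-*
        ; *-assoc = λ a b c → ≈⇒≡ (*-assoc a b c)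
        ; *-identity = (λ a → ≈⇒≡ (*-identityˡ a)) , (λ a → ≈⇒≡ (*-identityʳ a))
        ; distrib = (λ a b c → ≈⇒≡ (distribˡ a b c)) , (λ a b c → ≈⇒≡ (distribʳ a b c)) }
      ; *-comm = λ a b → ≈⇒≡ (*-comm a b) } }

  coarsen : ∀ {p m x y} → Divides R p m → x ≡ y [mod m ] → x ≡ y [mod p ]
  coarsen {p} {m} {x} {y} (t , m≈pt) (k , x≈y+mk) = t * k , (begin
    x               ≈⟨ x≈y+mk ⟩
    y + m * k       ≈⟨ +-congˡ (*-congʳ m≈pt) ⟩
    y + (p * t) * k ≈⟨ +-congˡ (*-assoc p t k) ⟩
    y + p * (t * k) ∎)

  ∣-trans : ∀ {a b d} → Divides R a b → Divides R b d → Divides R a d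
  ∣-trans {a} {b} {d} (t , b≈at) (t′ , d≈bt′) = t * t′ , (begin
    d            ≈⟨ d≈bt′ ⟩
    b * t′       ≈⟨ *-congʳ b≈at ⟩
    (a * t) * t′ ≈⟨ *-assoc a t t′ ⟩
    a * (t * t′) ∎)

  scale-congruence : ∀ {m x y} s → x ≡ y [mod m ] → s * x ≡ s * y [mod m * s ]
  scale-congruence {m} {x} {y} s (k , x≈y+mk) = k , (begin
    s * x             ≈⟨ *-congˡ x≈y+mk ⟩
    s * (y + m * k)   ≈⟨ solve 4 (λ s y m k → s :* (y :+ m :* k) := s :* y :+ (m :* s) :* k) refl s y m k ⟩
    s * y + (m * s) * k ∎)

  multiple≡0 : ∀ p y → p * y ≡ 0# [mod p ]
  multiple≡0 p y = y , sym (+-identityˡ _)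

  pow-divides : ∀ q {a b} → a ≤ b → Divides R (pow R q a) (pow R q b)
  pow-divides q {b = b} z≤n       = pow R q b , sym (*-identityˡ _)
  pow-divides q (s≤s a≤b) with pow-divides q a≤b
  ... | t , qᵇ≈qᵃt = t , trans (*-congˡ qᵇ≈qᵃt) (sym (*-assoc _ _ _))

module PolynomialsMod {c ℓ : Level} (R : CommutativeRing c ℓ) (m : CommutativeRing.Carrier R) where
  open Basics R
  open Congruence R using (quotient; ≈⇒≡)
  private module Exact = CommutativeRing R
  open CommutativeRing (quotient m)
  module ≈-Reasoning = SetoidReasoning setoid
  open SemiringSolver commutativeSemiring using (solve; _:=_; _:+_; _:*_)

  infix 4 _≋_
  _≋_ : Poly R → Poly R → Set (c ⊔ ℓ)
  f ≋ g = f ≋ g [mod m ]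

  ≋-setoid : Setoid c (c ⊔ ℓ)
  ≋-setoid = record
    { Carrier = Poly R ; _≈_ = _≋_
    ; isEquivalence = record
      { refl  = coeffwise λ _ → refl
      ; sym   = λ p → coeffwise λ n → sym (at p n)
      ; trans = λ p q → coeffwise λ n → trans (at p n) (at q n) } }

  open Setoid ≋-setoid public using () renaming (refl to ≋-refl; sym to ≋-sym; trans to ≋-trans)
  module ≋-Reasoning = SetoidReasoning ≋-setoid

  coeff-⊞ : ∀ f g n → (f ⊞ g) ⟨ n ⟩ ≈ f ⟨ n ⟩ + g ⟨ n ⟩
  coeff-⊞ []      g       n       = sym (+-identityˡ _)
  coeff-⊞ (a ∷ f) []      n       = sym (+-identityʳ _)
  coeff-⊞ (a ∷ f) (b ∷ g) zero    = refl
  coeff-⊞ (a ∷ f) (b ∷ g) (suc n) = coeff-⊞ f g n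

  coeff-• : ∀ a f n → (a • f) ⟨ n ⟩ ≈ a * f ⟨ n ⟩
  coeff-• a []      n       = sym (zeroʳ a)
  coeff-• a (b ∷ f) zero    = refl
  coeff-• a (b ∷ f) (suc n) = coeff-• a f n

  ⊞-[] : ∀ f → f ⊞ [] ≋ f
  ⊞-[] f = coeffwise λ n → trans (coeff-⊞ f [] n) (+-identityʳ _)

  ∷-cong : ∀ {a b f g} → a ≈ b → f ≋ g → a ∷ f ≋ b ∷ g
  ∷-cong a≈b f≋g = coeffwise λ { zero → a≈b ; (suc n) → at f≋g n }

  ⊞-cong : ∀ {f f′ g g′} → f ≋ f′ → g ≋ g′ → f ⊞ g ≋ f′ ⊞ g′
  ⊞-cong {f} {f′} {g} {g′} f≋f′ g≋g′ = coeffwise λ n → begin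
    (f ⊞ g) ⟨ n ⟩          ≈⟨ coeff-⊞ f g n ⟩
    f ⟨ n ⟩ + g ⟨ n ⟩      ≈⟨ +-cong (at f≋f′ n) (at g≋g′ n) ⟩
    f′ ⟨ n ⟩ + g′ ⟨ n ⟩    ≈⟨ coeff-⊞ f′ g′ n ⟨
    (f′ ⊞ g′) ⟨ n ⟩        ∎
    where open ≈-Reasoning

  ⊞-congˡ : ∀ f {g g′} → g ≋ g′ → f ⊞ g ≋ f ⊞ g′
  ⊞-congˡ f = ⊞-cong (≋-refl {f})

  •-cong : ∀ {a b f g} → a ≈ b → f ≋ g → a • f ≋ b • g
  •-cong {a} {b} {f} {g} a≈b f≋g = coeffwise λ n → begin
    (a • f) ⟨ n ⟩    ≈⟨ coeff-• a f n ⟩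
    a * f ⟨ n ⟩      ≈⟨ *-cong a≈b (at f≋g n) ⟩
    b * g ⟨ n ⟩      ≈⟨ coeff-• b g n ⟨
    (b • g) ⟨ n ⟩    ∎
    where open ≈-Reasoning

  ⊞-interchange : ∀ f g h k → (f ⊞ g) ⊞ (h ⊞ k) ≋ (f ⊞ h) ⊞ (g ⊞ k)
  ⊞-interchange f g h k = coeffwise λ n → begin
    ((f ⊞ g) ⊞ (h ⊞ k)) ⟨ n ⟩                   ≈⟨ trans (coeff-⊞ (f ⊞ g) (h ⊞ k) n) (+-cong (coeff-⊞ f g n) (coeff-⊞ h k n)) ⟩
    (f ⟨ n ⟩ + g ⟨ n ⟩) + (h ⟨ n ⟩ + k ⟨ n ⟩)   ≈⟨ solve 4 (λ x y z w → (x :+ y) :+ (z :+ w) := (x :+ z) :+ (y :+ w)) refl _ _ _ _ ⟩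
    (f ⟨ n ⟩ + h ⟨ n ⟩) + (g ⟨ n ⟩ + k ⟨ n ⟩)   ≈⟨ trans (coeff-⊞ (f ⊞ h) (g ⊞ k) n) (+-cong (coeff-⊞ f h n) (coeff-⊞ g k n)) ⟨
    ((f ⊞ h) ⊞ (g ⊞ k)) ⟨ n ⟩                   ∎
    where open ≈-Reasoning

  •-distrib-⊞ : ∀ a f g → a • (f ⊞ g) ≋ a • f ⊞ a • g
  •-distrib-⊞ a f g = coeffwise λ n → begin
    (a • (f ⊞ g)) ⟨ n ⟩           ≈⟨ trans (coeff-• a (f ⊞ g) n) (*-congˡ (coeff-⊞ f g n)) ⟩
    a * (f ⟨ n ⟩ + g ⟨ n ⟩)        ≈⟨ distribˡ a _ _ ⟩
    a * f ⟨ n ⟩ + a * g ⟨ n ⟩      ≈⟨ trans (coeff-⊞ (a • f) (a • g) n) (+-cong (coeff-• a f n) (coeff-• a g n)) ⟨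
    (a • f ⊞ a • g) ⟨ n ⟩         ∎
    where open ≈-Reasoning

  •-comm : ∀ a b f → a • (b • f) ≋ b • (a • f)
  •-comm a b f = coeffwise λ n → begin
    (a • (b • f)) ⟨ n ⟩    ≈⟨ trans (coeff-• a (b • f) n) (*-congˡ (coeff-• b f n)) ⟩
    a * (b * f ⟨ n ⟩)      ≈⟨ solve 3 (λ a b x → a :* (b :* x) := b :* (a :* x)) refl a b _ ⟩
    b * (a * f ⟨ n ⟩)      ≈⟨ trans (coeff-• b (a • f) n) (*-congˡ (coeff-• a f n)) ⟨
    (b • (a • f)) ⟨ n ⟩    ∎
    where open ≈-Reasoning

  •-identity : ∀ f → 1# • f ≋ f
  •-identity f = coeffwise λ n → trans (coeff-• 1# f n) (*-identityˡ _)

  •-zero : ∀ f → 0# • f ≋ []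
  •-zero f = coeffwise λ n → trans (coeff-• 0# f n) (zeroˡ _)

  zero-const : 0# ∷ [] ≋ []
  zero-const = coeffwise λ { zero → refl ; (suc n) → refl }

  ⊠-[] : ∀ g → g ⊠ [] ≋ []
  ⊠-[] []      = ≋-refl
  ⊠-[] (b ∷ g) = ≋-trans (∷-cong refl (⊠-[] g)) zero-const

  ⊠-const : ∀ g a → g ⊠ (a ∷ []) ≋ a • g
  ⊠-const []      a = ≋-refl
  ⊠-const (b ∷ g) a = ∷-cong (trans (+-identityʳ _) (*-comm b a)) (⊠-const g a)

  ≋-tail : ∀ {f g} → f ≋ g → tail f ≋ tail g
  ≋-tail {f} {g} f≋g = coeffwise λ n →
    trans (≈⇒≡ (Exact.sym (coeff-tail f n))) (trans (at f≋g (suc n)) (≈⇒≡ (coeff-tail g n)))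

  ⊠-unfold : ∀ f g → f ⊠ g ≋ f ⟨ 0 ⟩ • g ⊞ (0# ∷ tail f ⊠ g)
  ⊠-unfold []      g = ≋-sym (≋-trans (⊞-cong (•-zero g) zero-const) (⊠-[] []))
  ⊠-unfold (a ∷ f) g = ≋-refl

  ◦-unfold : ∀ f g → f ◦ g ≋ (f ⟨ 0 ⟩ ∷ []) ⊞ g ⊠ (tail f ◦ g)
  ◦-unfold []      g = ≋-sym (⊞-cong zero-const (⊠-[] g))
  ◦-unfold (a ∷ f) g = ≋-refl

  ⊠-cong : ∀ {f f′ g g′} → f ≋ f′ → g ≋ g′ → f ⊠ g ≋ f′ ⊠ g′
  ⊠-cong {f} {f′} f≋f′ = pair-induction P (λ _ _ → ≋-refl) step f f′ f≋f′
    where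
    P : Poly R → Poly R → Set (c ⊔ ℓ)
    P f f′ = f ≋ f′ → ∀ {g g′} → g ≋ g′ → f ⊠ g ≋ f′ ⊠ g′
    step : ∀ f f′ → P (tail f) (tail f′) → P f f′
    step f f′ tail-cong f≋f′ {g} {g′} g≋g′ = ≋-trans (⊠-unfold f g) (≋-trans
      (⊞-cong (•-cong (at f≋f′ 0) g≋g′) (∷-cong refl (tail-cong (≋-tail f≋f′) g≋g′)))
      (≋-sym (⊠-unfold f′ g′)))

  ⊠-congˡ : ∀ g {h h′} → h ≋ h′ → g ⊠ h ≋ g ⊠ h′
  ⊠-congˡ g = ⊠-cong (≋-refl {g})

  ◦-cong : ∀ {f f′ g g′} → f ≋ f′ → g ≋ g′ → f ◦ g ≋ f′ ◦ g′
  ◦-cong {f} {f′} f≋f′ = pair-induction P (λ _ _ → ≋-refl) step f f′ f≋f′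
    where
    P : Poly R → Poly R → Set (c ⊔ ℓ)
    P f f′ = f ≋ f′ → ∀ {g g′} → g ≋ g′ → f ◦ g ≋ f′ ◦ g′
    step : ∀ f f′ → P (tail f) (tail f′) → P f f′
    step f f′ tail-cong f≋f′ {g} {g′} g≋g′ = ≋-trans (◦-unfold f g) (≋-trans
      (⊞-cong (∷-cong (at f≋f′ 0) (≋-refl {[]})) (⊠-cong g≋g′ (tail-cong (≋-tail f≋f′) g≋g′)))
      (≋-sym (◦-unfold f′ g′)))

  ⊠-distrib-⊞ : ∀ g h h′ → g ⊠ (h ⊞ h′) ≋ g ⊠ h ⊞ g ⊠ h′
  ⊠-distrib-⊞ []      h h′ = ≋-refl
  ⊠-distrib-⊞ (b ∷ g) h h′ = begin
    b • (h ⊞ h′) ⊞ (0# ∷ g ⊠ (h ⊞ h′))                   ≈⟨ ⊞-cong (•-distrib-⊞ b h h′) (∷-cong (sym (+-identityˡ 0#)) (⊠-distrib-⊞ g h h′)) ⟩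
    (b • h ⊞ b • h′) ⊞ ((0# ∷ g ⊠ h) ⊞ (0# ∷ g ⊠ h′))   ≈⟨ ⊞-interchange (b • h) (b • h′) (0# ∷ g ⊠ h) (0# ∷ g ⊠ h′) ⟩
    (b • h ⊞ (0# ∷ g ⊠ h)) ⊞ (b • h′ ⊞ (0# ∷ g ⊠ h′))   ∎
    where open ≋-Reasoning

  ⊠-• : ∀ g a h → g ⊠ (a • h) ≋ a • (g ⊠ h)
  ⊠-• []      a h = ≋-refl
  ⊠-• (b ∷ g) a h = begin
    b • (a • h) ⊞ (0# ∷ g ⊠ (a • h))     ≈⟨ ⊞-cong (•-comm b a h) (∷-cong (sym (zeroʳ a)) (⊠-• g a h)) ⟩
    a • (b • h) ⊞ a • (0# ∷ g ⊠ h)       ≈⟨ •-distrib-⊞ a (b • h) (0# ∷ g ⊠ h) ⟨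
    a • (b • h ⊞ (0# ∷ g ⊠ h))           ∎
    where open ≋-Reasoning

  ◦-distrib-⊞ : ∀ f f′ g → (f ⊞ f′) ◦ g ≋ f ◦ g ⊞ f′ ◦ g
  ◦-distrib-⊞ []      f′       g = ≋-refl
  ◦-distrib-⊞ (a ∷ f) []       g = ≋-sym (⊞-[] _)
  ◦-distrib-⊞ (a ∷ f) (b ∷ f′) g = begin
    ((a ∷ []) ⊞ (b ∷ [])) ⊞ g ⊠ ((f ⊞ f′) ◦ g)                    ≈⟨ ⊞-congˡ ((a ∷ []) ⊞ (b ∷ [])) (⊠-congˡ g (◦-distrib-⊞ f f′ g)) ⟩
    ((a ∷ []) ⊞ (b ∷ [])) ⊞ g ⊠ (f ◦ g ⊞ f′ ◦ g)                  ≈⟨ ⊞-congˡ ((a ∷ []) ⊞ (b ∷ [])) (⊠-distrib-⊞ g (f ◦ g) (f′ ◦ g)) ⟩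
    ((a ∷ []) ⊞ (b ∷ [])) ⊞ (g ⊠ (f ◦ g) ⊞ g ⊠ (f′ ◦ g))          ≈⟨ ⊞-interchange (a ∷ []) (b ∷ []) (g ⊠ (f ◦ g)) (g ⊠ (f′ ◦ g)) ⟩
    ((a ∷ []) ⊞ g ⊠ (f ◦ g)) ⊞ ((b ∷ []) ⊞ g ⊠ (f′ ◦ g))          ∎
    where open ≋-Reasoning

  •-◦ : ∀ a f g → (a • f) ◦ g ≋ a • (f ◦ g)
  •-◦ a []      g = ≋-refl
  •-◦ a (b ∷ f) g = begin
    (a • (b ∷ [])) ⊞ g ⊠ ((a • f) ◦ g)   ≈⟨ ⊞-congˡ (a • (b ∷ [])) (⊠-congˡ g (•-◦ a f g)) ⟩
    (a • (b ∷ [])) ⊞ g ⊠ (a • (f ◦ g))   ≈⟨ ⊞-congˡ (a • (b ∷ [])) (⊠-• g a (f ◦ g)) ⟩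
    (a • (b ∷ [])) ⊞ a • (g ⊠ (f ◦ g))   ≈⟨ •-distrib-⊞ a (b ∷ []) (g ⊠ (f ◦ g)) ⟨
    a • ((b ∷ []) ⊞ g ⊠ (f ◦ g))         ∎
    where open ≋-Reasoning

  affine-◦ : ∀ a₀ a₁ g → affine a₀ a₁ ◦ g ≋ (a₀ ∷ []) ⊞ a₁ • g
  affine-◦ a₀ a₁ g = ⊞-congˡ (a₀ ∷ []) (≋-trans (⊠-congˡ g (⊞-congˡ (a₁ ∷ []) (⊠-[] g))) (⊠-const g a₁))

  X-◦ : ∀ g → X ◦ g ≋ g
  X-◦ g = ≋-trans (affine-◦ 0# 1# g) (⊞-cong zero-const (•-identity g))

  X-⊠ : ∀ h → X ⊠ h ≋ 0# ∷ h
  X-⊠ h = begin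
    0# • h ⊞ (0# ∷ (1# • h ⊞ (0# ∷ [] ⊠ h)))   ≈⟨ ⊞-cong (•-zero h) (∷-cong refl (⊞-cong (•-identity h) zero-const)) ⟩
    0# ∷ (h ⊞ [])                             ≈⟨ ∷-cong refl (⊞-[] h) ⟩
    0# ∷ h                                    ∎
    where open ≋-Reasoning

  ◦-X : ∀ f → f ◦ X ≋ f
  ◦-X []      = ≋-refl
  ◦-X (a ∷ f) = ≋-trans (⊞-congˡ (a ∷ []) (≋-trans (X-⊠ (f ◦ X)) (∷-cong refl (◦-X f)))) (∷-cong (+-identityʳ a) (≋-refl {f}))

  inverse-of-X : ∀ {f g} → f ≋ X → g ◦ f ≋ X → g ≋ X
  inverse-of-X {f} {g} f≋X gf≋X = ≋-trans (≋-sym (◦-X g)) (≋-trans (◦-cong (≋-refl {g}) (≋-sym f≋X)) gf≋X)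

  affine-◦ₐ : ∀ {f g a₀ a₁ b₀ b₁} → f ≋ affine a₀ a₁ → g ≋ affine b₀ b₁
            → f ◦ g ≋ affine (a₀ + a₁ * b₀) (a₁ * b₁)
  affine-◦ₐ {a₀ = a₀} {a₁} {b₀} {b₁} f≋ g≋ = ≋-trans (◦-cong f≋ g≋) (affine-◦ a₀ a₁ (affine b₀ b₁))

  affine-right-inverse : ∀ {f g a₀ a₁} → f ≋ affine a₀ a₁ → f ◦ g ≋ X
                       → a₁ * g ⟨ 1 ⟩ ≈ 1# × g ≋ affine (g ⟨ 0 ⟩) (g ⟨ 1 ⟩)
  affine-right-inverse {f} {g} {a₀} {a₁} f≋ fg≋X = a₁g₁≈1 , coeffwise higher
    where
    a₀+a₁g≋X : (a₀ ∷ []) ⊞ a₁ • g ≋ X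
    a₀+a₁g≋X = ≋-trans (≋-sym (≋-trans (◦-cong f≋ (≋-refl {g})) (affine-◦ a₀ a₁ g))) fg≋X

    a₁g≈X : ∀ n → a₁ * g ⟨ suc n ⟩ ≈ X ⟨ suc n ⟩
    a₁g≈X n = begin
      a₁ * g ⟨ suc n ⟩                    ≈⟨ +-identityˡ _ ⟨
      0# + a₁ * g ⟨ suc n ⟩               ≈⟨ +-congˡ (coeff-• a₁ g (suc n)) ⟨
      0# + (a₁ • g) ⟨ suc n ⟩             ≈⟨ coeff-⊞ (a₀ ∷ []) (a₁ • g) (suc n) ⟨
      ((a₀ ∷ []) ⊞ a₁ • g) ⟨ suc n ⟩      ≈⟨ at a₀+a₁g≋X (suc n) ⟩
      X ⟨ suc n ⟩                         ∎
      where open ≈-Reasoning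

    a₁g₁≈1 : a₁ * g ⟨ 1 ⟩ ≈ 1#
    a₁g₁≈1 = a₁g≈X 0

    higher : ∀ n → g ⟨ n ⟩ ≈ affine (g ⟨ 0 ⟩) (g ⟨ 1 ⟩) ⟨ n ⟩
    higher zero          = refl
    higher (suc zero)    = refl
    higher (suc (suc n)) = begin
      g ⟨ 2+n ⟩                        ≈⟨ *-identityˡ _ ⟨
      1# * g ⟨ 2+n ⟩                   ≈⟨ *-congʳ a₁g₁≈1 ⟨
      (a₁ * g ⟨ 1 ⟩) * g ⟨ 2+n ⟩        ≈⟨ solve 3 (λ a u v → (a :* u) :* v := u :* (a :* v)) refl a₁ (g ⟨ 1 ⟩) (g ⟨ 2+n ⟩) ⟩
      g ⟨ 1 ⟩ * (a₁ * g ⟨ 2+n ⟩)        ≈⟨ *-congˡ (a₁g≈X (suc n)) ⟩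
      g ⟨ 1 ⟩ * 0#                     ≈⟨ zeroʳ _ ⟩
      0#                               ∎
      where
      open ≈-Reasoning
      2+n : ℕ
      2+n = suc (suc n)

module ChangeOfModulus {c ℓ : Level} (R : CommutativeRing c ℓ) where
  open CommutativeRing R
  open Basics R
  open Congruence R
  open PolynomialsMod R using (coeff-⊞; coeff-•; ≋-tail)

  ≋-coarsen : ∀ {p m f g} → Divides R p m → f ≋ g [mod m ] → f ≋ g [mod p ]
  ≋-coarsen p∣m f≋g = coeffwise λ n → coarsen p∣m (at f≋g n)

  ≋-scale : ∀ {q f g} s → f ≋ g [mod q ] → s • f ≋ s • g [mod q * s ]
  ≋-scale {q} {f} {g} s f≋g = coeffwise λ n →
    Q.trans (coeff-• (q * s) s f n) (Q.trans (scale-congruence s (at f≋g n)) (Q.sym (coeff-• (q * s) s g n)))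
    where module Q = CommutativeRing (quotient (q * s))

  •-vanishes : ∀ s f → s • f ≋ [] [mod s ]
  •-vanishes s f = coeffwise λ n → Q.trans (coeff-• s s f n) (multiple≡0 s (f ⟨ n ⟩))
    where module Q = CommutativeRing (quotient s)

  poly-quotient : ∀ {s f g} m → f ≋ g [mod s ] → Σ (Poly R) λ a → f ≋ g ⊞ s • a [mod m ]
  poly-quotient {s} {f} {g} m f≋g = a , coeffwise λ n →
    Q.trans (≈⇒≡ (f≈g+sa n)) (Q.sym (Q.trans (coeff-⊞ m g (s • a) n) (Q.+-congˡ (coeff-• m s a n))))
    where
    module Q = CommutativeRing (quotient m)
    exact : ∀ f g → f ≋ g [mod s ] → Σ (Poly R) λ a → ∀ n → f ⟨ n ⟩ ≈ g ⟨ n ⟩ + s * a ⟨ n ⟩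
    exact = pair-induction P (λ _ → [] , λ _ → sym (trans (+-congˡ (zeroʳ s)) (+-identityʳ 0#))) step
      where
      P : Poly R → Poly R → Set (c ⊔ ℓ)
      P f g = f ≋ g [mod s ] → Σ (Poly R) λ a → ∀ n → f ⟨ n ⟩ ≈ g ⟨ n ⟩ + s * a ⟨ n ⟩
      step : ∀ f g → P (tail f) (tail g) → P f g
      step f g tail-quotient f≋g with at f≋g 0 | tail-quotient (≋-tail s f≋g)
      ... | k , f₀≈g₀+sk | a , tail≈ = k ∷ a , λ
        { zero    → f₀≈g₀+sk
        ; (suc n) → trans (coeff-tail f n) (trans (tail≈ n) (+-congʳ (sym (coeff-tail g n)))) }
    a : Poly R
    a = proj₁ (exact f g f≋g)
    f≈g+sa : ∀ n → f ⟨ n ⟩ ≈ g ⟨ n ⟩ + s * a ⟨ n ⟩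
    f≈g+sa = proj₂ (exact f g f≋g)

-- Polynomials T + s·a.  When p divides s², they compose modulo p by adding
-- the a's: (T + s·a) ∘ (T + s·b) = T + s·b + s·a(T + s·b) and
-- a(T + s·b) ≡ a (mod s).  This makes {f ≡ T (mod s)} / {f ≡ T (mod p)} abelian.
module Shifts {c ℓ : Level} (R : CommutativeRing c ℓ) {s p : CommutativeRing.Carrier R}
              (p∣s² : Divides R p (CommutativeRing._*_ R s s)) where
  open Basics R
  open ChangeOfModulus R
  open PolynomialsMod R p
  open CommutativeRing (Congruence.quotient R p)
  open SemiringSolver commutativeSemiring using (solve; _:=_; _:+_; _:*_)
  open RingProperties ring using (+-cancelˡ)
  private module Mod-s = PolynomialsMod R s

  shift≋X : ∀ a → X ⊞ s • a ≋ X [mod s ]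
  shift≋X a = Mod-s.⊞-congˡ X (•-vanishes s a)

  expand : ∀ a n → (X ⊞ s • a) ⟨ n ⟩ ≈ X ⟨ n ⟩ + s * a ⟨ n ⟩
  expand a n = trans (coeff-⊞ X (s • a) n) (+-congˡ (coeff-• s a n))

  shift-sum : ∀ a b → (X ⊞ s • b) ⊞ s • a ≋ X ⊞ s • (a ⊞ b)
  shift-sum a b = coeffwise λ n → begin
    ((X ⊞ s • b) ⊞ s • a) ⟨ n ⟩           ≈⟨ trans (coeff-⊞ (X ⊞ s • b) (s • a) n) (+-cong (expand b n) (coeff-• s a n)) ⟩
    (X ⟨ n ⟩ + s * b ⟨ n ⟩) + s * a ⟨ n ⟩  ≈⟨ solve 4 (λ t s a b → (t :+ s :* b) :+ s :* a := t :+ s :* (a :+ b)) refl (X ⟨ n ⟩) s (a ⟨ n ⟩) (b ⟨ n ⟩) ⟩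
    X ⟨ n ⟩ + s * (a ⟨ n ⟩ + b ⟨ n ⟩)      ≈⟨ trans (expand (a ⊞ b) n) (+-congˡ (*-congˡ (coeff-⊞ a b n))) ⟨
    (X ⊞ s • (a ⊞ b)) ⟨ n ⟩                ∎
    where open ≈-Reasoning

  shift-unique : ∀ {f a b} → f ≋ X ⊞ s • a → f ≋ X ⊞ s • b → ∀ n → s * a ⟨ n ⟩ ≈ s * b ⟨ n ⟩
  shift-unique {f} {a} {b} f≋a f≋b n = +-cancelˡ (X ⟨ n ⟩) _ _ (begin
    X ⟨ n ⟩ + s * a ⟨ n ⟩    ≈⟨ expand a n ⟨
    (X ⊞ s • a) ⟨ n ⟩        ≈⟨ at f≋a n ⟨
    f ⟨ n ⟩                  ≈⟨ at f≋b n ⟩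
    (X ⊞ s • b) ⟨ n ⟩        ≈⟨ expand b n ⟩
    X ⟨ n ⟩ + s * b ⟨ n ⟩    ∎)
    where open ≈-Reasoning

  shift-trivial : ∀ {f a} → f ≋ X ⊞ s • a → (∀ n → 0# ≈ s * a ⟨ n ⟩) → f ≋ X
  shift-trivial {f} {a} f≋ 0≈sa = coeffwise λ n → begin
    f ⟨ n ⟩                  ≈⟨ at f≋ n ⟩
    (X ⊞ s • a) ⟨ n ⟩        ≈⟨ expand a n ⟩
    X ⟨ n ⟩ + s * a ⟨ n ⟩    ≈⟨ +-congˡ (0≈sa n) ⟨
    X ⟨ n ⟩ + 0#             ≈⟨ +-identityʳ _ ⟩
    X ⟨ n ⟩                  ∎
    where open ≈-Reasoning

  shift-◦ : ∀ {f g a b} → f ≋ X ⊞ s • a → g ≋ X ⊞ s • b → f ◦ g ≋ X ⊞ s • (a ⊞ b)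
  shift-◦ {f} {g} {a} {b} f≋ g≋ = begin
    f ◦ g                     ≈⟨ ◦-cong f≋ g≋ ⟩
    (X ⊞ s • a) ◦ G           ≈⟨ ◦-distrib-⊞ X (s • a) G ⟩
    X ◦ G ⊞ (s • a) ◦ G       ≈⟨ ⊞-cong (X-◦ G) (•-◦ s a G) ⟩
    G ⊞ s • (a ◦ G)           ≈⟨ ⊞-congˡ G (≋-coarsen p∣s² (≋-scale s aG≋a)) ⟩
    G ⊞ s • a                 ≈⟨ shift-sum a b ⟩
    X ⊞ s • (a ⊞ b)           ∎
    where
    open ≋-Reasoning
    G : Poly R
    G = X ⊞ s • b
    -- G ≡ T (mod s), so a ∘ G ≡ a ∘ T = a (mod s)
    aG≋a : a ◦ G ≋ a [mod s ]
    aG≋a = Mod-s.≋-trans (Mod-s.◦-cong (Mod-s.≋-refl {a}) (shift≋X b)) (Mod-s.◦-X a)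

-- A partial homomorphism χ from Aut(A¹_{R/mR}) to a commutative monoid M,
-- given as a relation "f has value u": its domain is closed under
-- composition and inverses and contains T, and the value is well defined.
-- Commutators have trivial value, so the derived subgroup of any subgroup
-- inside the domain lies in the kernel of χ.
module Characters {c ℓ : Level} (R : CommutativeRing c ℓ) (m : CommutativeRing.Carrier R) where
  open Basics R

  record IsCharacter {a e r : Level} (M : CommutativeMonoid a e)
                     (Value : Poly R → CommutativeMonoid.Carrier M → Set r)
                     : Set (c ⊔ ℓ ⊔ a ⊔ e ⊔ r) where
    open CommutativeMonoid M
    field
      respects : ∀ {f g u} → f ≋ g [mod m ] → Value g u → Value f u
      cong     : ∀ {f u v} → u ≈ v → Value f u → Value f v
      unique   : ∀ {f u v} → Value f u → Value f v → u ≈ v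
      compose  : ∀ {f g u v} → Value f u → Value g v → Value (f ◦ g) (u ∙ v)
      identity : Value X ε
      inverse  : ∀ {f g u} → Value f u → IsInverse R m f g → Σ Carrier (Value g)

  module _ {a e r : Level} {M : CommutativeMonoid a e}
           {Value : Poly R → CommutativeMonoid.Carrier M → Set r} (χ : IsCharacter M Value) where
    open CommutativeMonoid M hiding (identity)
    open IsCharacter χ
    open SetoidReasoning setoid
    open MonoidSolver M using (solve; _⊜_; id) renaming (_⊕_ to _⊙_)

    inverse-value : ∀ {f g u} → Value f u → IsInverse R m f g → Σ Carrier λ v → Value g v × u ∙ v ≈ ε
    inverse-value vf f⁻¹ with inverse vf f⁻¹
    ... | v , vg = v , vg , unique (compose vf vg) (respects (coeffwise (proj₁ f⁻¹)) identity)

    commutator-value : ∀ {u u′ v v′} → u ∙ u′ ≈ ε → v ∙ v′ ≈ ε → (u ∙ (v ∙ (u′ ∙ v′))) ∙ ε ≈ ε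
    commutator-value {u} {u′} {v} {v′} uu′≈ε vv′≈ε = begin
      (u ∙ (v ∙ (u′ ∙ v′))) ∙ ε   ≈⟨ solve 4 (λ u v u′ v′ → (u ⊙ (v ⊙ (u′ ⊙ v′))) ⊙ id ⊜ (u ⊙ u′) ⊙ (v ⊙ v′)) refl u v u′ v′ ⟩
      (u ∙ u′) ∙ (v ∙ v′)         ≈⟨ ∙-cong uu′≈ε vv′≈ε ⟩
      ε ∙ ε                       ≈⟨ identityˡ ε ⟩
      ε                           ∎

    derived-in-kernel : (H : Poly R → Set (c ⊔ ℓ)) → (∀ f → H f → Σ Carrier (Value f))
                      → ∀ f → Derived R m H f → Value f ε
    derived-in-kernel H H⊆dom _ (derived-id f f≋X) = respects (coeffwise f≋X) identity
    derived-in-kernel H H⊆dom _ (derived-mul x x′ y y′ h f Hx Hy x⁻¹ y⁻¹ Dh f≋[x,y]h)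
      with H⊆dom x Hx | H⊆dom y Hy
    ... | u , vx | v , vy with inverse-value vx x⁻¹ | inverse-value vy y⁻¹
    ... | u′ , vx′ , uu′≈ε | v′ , vy′ , vv′≈ε =
      cong (commutator-value uu′≈ε vv′≈ε)
           (respects (coeffwise f≋[x,y]h)
                     (compose (compose vx (compose vy (compose vx′ vy′))) (derived-in-kernel H H⊆dom h Dh)))

module Layers {c ℓ : Level} (R : CommutativeRing c ℓ) (m : CommutativeRing.Carrier R) where
  open Basics R
  open Congruence R using (quotient)
  open ChangeOfModulus R
  open Characters R m

  module AffineLayer {p : CommutativeRing.Carrier R} (p∣m : Divides R p m) where
    open CommutativeRing (quotient p)
    open PolynomialsMod R p

    LinearCoefficient : Poly R → Carrier → Set (c ⊔ ℓ)
    LinearCoefficient f a₁ = Σ Carrier λ a₀ → f ≋ affine a₀ a₁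

    linear-coefficient : IsCharacter *-commutativeMonoid LinearCoefficient
    linear-coefficient = record
      { respects = respects ; cong = cong′ ; unique = unique ; compose = compose
      ; identity = 0# , ≋-refl ; inverse = inverse }
      where
      respects : ∀ {f g u} → f ≋ g [mod m ] → LinearCoefficient g u → LinearCoefficient f u
      respects f≋g (a₀ , g≋) = a₀ , ≋-trans (≋-coarsen p∣m f≋g) g≋

      cong′ : ∀ {f u v} → u ≈ v → LinearCoefficient f u → LinearCoefficient f v
      cong′ a₁≈b₁ (a₀ , f≋) = a₀ , ≋-trans f≋ (∷-cong refl (∷-cong a₁≈b₁ (≋-refl {[]})))

      unique : ∀ {f u v} → LinearCoefficient f u → LinearCoefficient f v → u ≈ v
      unique (_ , f≋₁) (_ , f≋₂) = trans (sym (at f≋₁ 1)) (at f≋₂ 1)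

      compose : ∀ {f g u v} → LinearCoefficient f u → LinearCoefficient g v → LinearCoefficient (f ◦ g) (u * v)
      compose (a₀ , f≋) (b₀ , g≋) = _ , affine-◦ₐ f≋ g≋

      inverse : ∀ {f g u} → LinearCoefficient f u → IsInverse R m f g → Σ Carrier (LinearCoefficient g)
      inverse (a₀ , f≋) f⁻¹ = _ , _ , proj₂ (affine-right-inverse f≋ (≋-coarsen p∣m (coeffwise (proj₁ f⁻¹))))

    derived-of-affine : (H : Poly R → Set (c ⊔ ℓ)) → (∀ f → H f → Σ Carrier (LinearCoefficient f))
                      → ∀ f → Derived R m H f → Σ Carrier λ a₀ → f ≋ affine a₀ 1#
    derived-of-affine = derived-in-kernel linear-coefficient

  module TranslationLayer {p : CommutativeRing.Carrier R} (p∣m : Divides R p m) where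
    open CommutativeRing (quotient p)
    open PolynomialsMod R p

    Translation : Poly R → Carrier → Set (c ⊔ ℓ)
    Translation f a₀ = f ≋ affine a₀ 1#

    translation-constant : IsCharacter +-commutativeMonoid Translation
    translation-constant = record
      { respects = respects ; cong = cong′ ; unique = unique ; compose = compose
      ; identity = ≋-refl ; inverse = inverse }
      where
      respects : ∀ {f g u} → f ≋ g [mod m ] → Translation g u → Translation f u
      respects f≋g g≋ = ≋-trans (≋-coarsen p∣m f≋g) g≋

      cong′ : ∀ {f u v} → u ≈ v → Translation f u → Translation f v
      cong′ a₀≈b₀ f≋ = ≋-trans f≋ (∷-cong a₀≈b₀ (≋-refl {1# ∷ []}))

      unique : ∀ {f u v} → Translation f u → Translation f v → u ≈ v
      unique f≋₁ f≋₂ = trans (sym (at f≋₁ 0)) (at f≋₂ 0)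

      compose : ∀ {f g u v} → Translation f u → Translation g v → Translation (f ◦ g) (u + v)
      compose f≋ g≋ = ≋-trans (affine-◦ₐ f≋ g≋) (∷-cong (+-congˡ (*-identityˡ _)) (∷-cong (*-identityˡ 1#) (≋-refl {[]})))

      inverse : ∀ {f g u} → Translation f u → IsInverse R m f g → Σ Carrier (Translation g)
      inverse {g = g} f≋ f⁻¹ = g ⟨ 0 ⟩ , ≋-trans g≋ (∷-cong refl (∷-cong g₁≈1 (≋-refl {[]})))
        where
        g-affine : 1# * g ⟨ 1 ⟩ ≈ 1# × g ≋ affine (g ⟨ 0 ⟩) (g ⟨ 1 ⟩)
        g-affine = affine-right-inverse f≋ (≋-coarsen p∣m (coeffwise (proj₁ f⁻¹)))
        g≋ : g ≋ affine (g ⟨ 0 ⟩) (g ⟨ 1 ⟩)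
        g≋ = proj₂ g-affine
        g₁≈1 : g ⟨ 1 ⟩ ≈ 1#
        g₁≈1 = trans (sym (*-identityˡ (g ⟨ 1 ⟩))) (proj₁ g-affine)

    derived-of-translations : (H : Poly R → Set (c ⊔ ℓ)) → (∀ f → H f → Σ Carrier (Translation f))
                            → ∀ f → Derived R m H f → f ≋ X
    derived-of-translations = derived-in-kernel translation-constant

  module ShiftLayer {s p : CommutativeRing.Carrier R} (s∣p : Divides R s p)
                    (p∣s² : Divides R p (CommutativeRing._*_ R s s)) (p∣m : Divides R p m) where
    open CommutativeRing (quotient p)
    open PolynomialsMod R p
    open Shifts R p∣s²
    private module Mod-s = PolynomialsMod R s

    Sequences : CommutativeMonoid c (c ⊔ ℓ)
    Sequences = Pointwise.commutativeMonoid ℕ +-commutativeMonoid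

    Shift : Poly R → (ℕ → Carrier) → Set (c ⊔ ℓ)
    Shift f u = Σ (Poly R) λ a → f ≋ X ⊞ s • a × (∀ n → u n ≈ s * a ⟨ n ⟩)

    shift-of : ∀ {f} → f ≋ X [mod s ] → Σ (ℕ → Carrier) (Shift f)
    shift-of f≋X = (λ n → s * a ⟨ n ⟩) , a , f≋ , λ n → refl
      where
      a : Poly R
      a = proj₁ (poly-quotient p f≋X)
      f≋ : _ ≋ X ⊞ s • a
      f≋ = proj₂ (poly-quotient p f≋X)

    shift-congruent : ∀ {f u} → Shift f u → f ≋ X [mod s ]
    shift-congruent (a , f≋ , _) = Mod-s.≋-trans (≋-coarsen s∣p f≋) (shift≋X a)

    shift-sequence : IsCharacter Sequences Shift
    shift-sequence = record
      { respects = respects ; cong = cong′ ; unique = unique ; compose = compose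
      ; identity = [] , ≋-refl , (λ n → sym (zeroʳ s)) ; inverse = inverse }
      where
      open CommutativeMonoid Sequences using () renaming (_≈_ to _≈ₛ_; _∙_ to _+ₛ_)

      respects : ∀ {f g u} → f ≋ g [mod m ] → Shift g u → Shift f u
      respects f≋g (a , g≋ , u≈) = a , ≋-trans (≋-coarsen p∣m f≋g) g≋ , u≈

      cong′ : ∀ {f u v} → u ≈ₛ v → Shift f u → Shift f v
      cong′ u≈v (a , f≋ , u≈) = a , f≋ , λ n → trans (sym (u≈v n)) (u≈ n)

      unique : ∀ {f u v} → Shift f u → Shift f v → u ≈ₛ v
      unique (a , f≋a , u≈) (b , f≋b , v≈) n = trans (u≈ n) (trans (shift-unique {a = a} {b} f≋a f≋b n) (sym (v≈ n)))

      compose : ∀ {f g u v} → Shift f u → Shift g v → Shift (f ◦ g) (u +ₛ v)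
      compose (a , f≋ , u≈) (b , g≋ , v≈) = a ⊞ b , shift-◦ {a = a} {b} f≋ g≋ , λ n →
        trans (+-cong (u≈ n) (v≈ n)) (trans (sym (distribˡ s _ _)) (*-congˡ (sym (coeff-⊞ a b n))))

      inverse : ∀ {f g u} → Shift f u → IsInverse R m f g → Σ (ℕ → Carrier) (Shift g)
      inverse vf f⁻¹ = shift-of (Mod-s.inverse-of-X (shift-congruent vf)
                                  (≋-coarsen (Congruence.∣-trans R s∣p p∣m) (coeffwise (proj₂ f⁻¹))))

    derived-of-shifts : (H : Poly R → Set (c ⊔ ℓ)) → (∀ f → H f → f ≋ X [mod s ])
                      → ∀ f → Derived R m H f → f ≋ X
    derived-of-shifts H H≋X f Df =
      shift-trivial {a = proj₁ trivial-shift} (proj₁ (proj₂ trivial-shift)) (proj₂ (proj₂ trivial-shift))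
      where
      trivial-shift : Shift f (λ _ → 0#)
      trivial-shift = derived-in-kernel shift-sequence H (λ g Hg → shift-of (H≋X g Hg)) f Df

module Solvability {c ℓ : Level} (R : CommutativeRing c ℓ) (q : CommutativeRing.Carrier R) where
  open CommutativeRing R
  open Basics R
  open Congruence R using (quotient; pow-divides; ≈⇒≡)
  open Layers R
  open SemiringSolver commutativeSemiring using (solve; _:=_; _:+_; _:*_; con)

  shape-affine : ∀ {n} a₀ a₁ (rest : Vec Carrier n) → shapePoly R q (a₀ ∷ a₁ ∷ rest) ≋ affine a₀ a₁ [mod pow R q 1 ]
  shape-affine a₀ a₁ rest = ∷-cong Q.refl (∷-cong (≈⇒≡ (*-identityˡ a₁)) (tail-vanishes 0 rest))
    where
    module Q = CommutativeRing (quotient (pow R q 1))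
    open PolynomialsMod R (pow R q 1)
    tail-vanishes : ∀ k {n} (rest : Vec Carrier n) → shapeTail R q (suc k) rest ≋ []
    tail-vanishes k []       = ≋-refl
    tail-vanishes k (r ∷ rs) = ≋-trans (∷-cong (pow R q k * r , qᵏ⁺¹r≈) (tail-vanishes (suc k) rs)) zero-const
      where
      qᵏ⁺¹r≈ : pow R q (suc k) * r ≈ 0# + pow R q 1 * (pow R q k * r)
      qᵏ⁺¹r≈ = solve 3 (λ q x r → (q :* x) :* r := con 0 :+ (q :* con 1) :* (x :* r)) refl q (pow R q k) r

  A-affine : ∀ {d} (1≤d : 1 ≤ d) → ∀ f → A R q d f → Σ Carrier (AffineLayer.LinearCoefficient (pow R q d) (pow-divides q 1≤d) f)
  A-affine {suc d} 1≤d f (_ , (a₀ ∷ a₁ ∷ rest) , f≋shape) =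
    a₁ , a₀ , PolynomialsMod.≋-trans R (pow R q 1) (ChangeOfModulus.≋-coarsen R (pow-divides q 1≤d) (coeffwise f≋shape)) (shape-affine a₀ a₁ rest)

  pow-divides-square : ∀ k → Divides R (pow R q (suc (suc k))) (pow R q (suc k) * pow R q (suc k))
  pow-divides-square k = pow R q k ,
    solve 2 (λ q x → (q :* x) :* (q :* x) := (q :* (q :* x)) :* x) refl q (pow R q k)

  congruence-series : ∀ {d} k → 1 ≤ k → k ≤ d
                    → ∀ f → DerivedSeries R (pow R q d) (A R q d) (suc k) f → f ≋ X [mod pow R q k ]
  congruence-series {d} (suc zero) _ 1≤d =
    TranslationLayer.derived-of-translations (pow R q d) q∣qᵈ _
      (AffineLayer.derived-of-affine (pow R q d) q∣qᵈ _ (A-affine 1≤d))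
    where
    q∣qᵈ : Divides R (pow R q 1) (pow R q d)
    q∣qᵈ = pow-divides q 1≤d
  congruence-series {d} (suc (suc k)) _ k+2≤d =
    ShiftLayer.derived-of-shifts (pow R q d) (pow-divides q (n≤1+n (suc k))) (pow-divides-square k) (pow-divides q k+2≤d) _
      (congruence-series (suc k) (s≤s z≤n) (<⇒≤ k+2≤d))

-- Theorem 4.3: A_d(R,q) is solvable; in fact its (d+1)-st derived subgroup
-- is trivial.
theorem4p3 : {c ℓ : Level} (R : CommutativeRing c ℓ) (q : CommutativeRing.Carrier R)
           → TorsionFree R q → PrincipalPrime R q
           → (d : ℕ) → 1 ≤ d → Solvable R (pow R q d) (A R q d)
theorem4p3 R q _ _ d 1≤d = suc d , λ f f∈Aᵈ⁺¹ → Basics.at (Solvability.congruence-series R q d 1≤d ≤-refl f f∈Aᵈ⁺¹)
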